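{- Let $\lesssim$ be a plausible preorder on $\mathcal{T}$ and $E(\cdot|\cdot)$ the conditional expectation naturally induced by it; write $P(C|D)=E(C|D)$. Let $X$ be a random quantity and $C,D$ events. Suppose $E(X|C.D)\in\{ -\infty,+\infty\}$ and there is a real number $p$ such that $-p\lesssim_D X.C\lesssim_D p$. Then $P(C|D)=0$.
   Context: Random quantities: $\mathcal{T}$ is a unital associative commutative algebra over $\mathbb{R}$; reals $r$ are identified with $r\mathbf{1}$; products are written $X.Y$. Events: idempotents $A$ ($A.A=A$). Plausible preorder: a relation $\lesssim$ on $\mathcal{T}$ with (i) $0\lesssim A$ for every event $A$; (ii) $0\lesssim X$ and $0\lesssim Y$ imply $0\lesssim X+Y$; (iii) $0\lesssim X$ and real $q\ge0$ imply $0\lesssim qX$; (iv) $X\lesssim Y$ iff $0\lesssim Y-X$. Strict part: $X\lnsim Y$ iff $X\lesssim Y$ and not $Y\lesssim X$. Conditional preorder: $X\lesssim_C Y$ iff $X.C\lesssim Y.C$; strict part $\lnsim_C$. Expectation induced by a plausible preorder: $E(X)$ is the real $x$ if $-\epsilon\lnsim X-x\lnsim\epsilon$ for all reals $\epsilon>0$; it is $+\infty$ if $y\lnsim X$ for all reals $y$; it is $-\infty$ if $X\lnsim y$ for all reals $y$; it is undefined otherwise. Conditional expectation: $E(X|C)$ is the expectation induced by $\lesssim_C$. Conditional probability: $P(C|D)=E(C|D)$. -}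

module Defs where

open import Level using (0ℓ)
open import Data.Product using (Σ; _×_; _,_)
open import Data.Sum using (_⊎_)
open import Relation.Nullary using (¬_)
open import Relation.Binary.PropositionalEquality using (_≡_; _≢_)

-- The real numbers, axiomatised as a Dedekind-complete ordered field
-- (unique up to isomorphism, so quantifying over all models = the reals).
record Reals : Set₁ where
  infixl 6 _+_
  infixl 7 _*_
  infix 4 _≤_ _<_
  field
    ℝ    : Set
    0r 1r : ℝ
    _+_ _*_ : ℝ → ℝ → ℝ
    -_   : ℝ → ℝ
    _≤_  : ℝ → ℝ → Set
    +-assoc : ∀ x y z → (x + y) + z ≡ x + (y + z)
    +-comm  : ∀ x y → x + y ≡ y + x
    +-idˡ   : ∀ x → 0r + x ≡ x
    +-invˡ  : ∀ x → (- x) + x ≡ 0r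
    *-assoc : ∀ x y z → (x * y) * z ≡ x * (y * z)
    *-comm  : ∀ x y → x * y ≡ y * x
    *-idˡ   : ∀ x → 1r * x ≡ x
    distribˡ : ∀ x y z → x * (y + z) ≡ x * y + x * z
    0≢1     : 0r ≢ 1r
    *-inv   : ∀ x → x ≢ 0r → Σ ℝ (λ y → x * y ≡ 1r)
    ≤-refl    : ∀ x → x ≤ x
    ≤-trans   : ∀ {x y z} → x ≤ y → y ≤ z → x ≤ z
    ≤-antisym : ∀ {x y} → x ≤ y → y ≤ x → x ≡ y
    ≤-total   : ∀ x y → x ≤ y ⊎ y ≤ x
    +-mono-≤  : ∀ {x y} z → x ≤ y → x + z ≤ y + z
    *-nonneg  : ∀ {x y} → 0r ≤ x → 0r ≤ y → 0r ≤ x * y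
    complete  : (S : ℝ → Set) → Σ ℝ S → Σ ℝ (λ b → ∀ x → S x → x ≤ b) →
                Σ ℝ (λ s → (∀ x → S x → x ≤ s) ×
                           (∀ b → (∀ x → S x → x ≤ b) → s ≤ b))

  _<_ : ℝ → ℝ → Set
  x < y = (x ≤ y) × (x ≢ y)

record RAlgebra (R : Reals) : Set₁ where
  open Reals R using (ℝ) renaming (_+_ to _+ʳ_; _*_ to _*ʳ_; 0r to 0ʳ; 1r to 1ʳ)
  infixl 6 _+_
  infixl 7 _∙_
  infixr 8 _•_
  field
    𝒯   : Set
    𝟎 𝟏 : 𝒯
    _+_ : 𝒯 → 𝒯 → 𝒯
    -_  : 𝒯 → 𝒯
    _∙_ : 𝒯 → 𝒯 → 𝒯
    _•_ : ℝ → 𝒯 → 𝒯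
    +-assoc : ∀ x y z → (x + y) + z ≡ x + (y + z)
    +-comm  : ∀ x y → x + y ≡ y + x
    +-idˡ   : ∀ x → 𝟎 + x ≡ x
    +-invˡ  : ∀ x → (- x) + x ≡ 𝟎
    ∙-assoc : ∀ x y z → (x ∙ y) ∙ z ≡ x ∙ (y ∙ z)
    ∙-comm  : ∀ x y → x ∙ y ≡ y ∙ x
    ∙-idˡ   : ∀ x → 𝟏 ∙ x ≡ x
    distribˡ : ∀ x y z → x ∙ (y + z) ≡ x ∙ y + x ∙ z
    •-distrib-+ᵀ : ∀ r x y → r • (x + y) ≡ r • x + r • y
    •-distrib-+ʳ : ∀ r s x → (r +ʳ s) • x ≡ r • x + s • x
    •-assoc : ∀ r s x → (r *ʳ s) • x ≡ r • (s • x)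
    •-id    : ∀ x → 1ʳ • x ≡ x
    •-∙     : ∀ r x y → (r • x) ∙ y ≡ r • (x ∙ y)

  -- reals r are identified with r𝟏
  ι : ℝ → 𝒯
  ι r = r • 𝟏

  _-_ : 𝒯 → 𝒯 → 𝒯
  x - y = x + (- y)

  IsEvent : 𝒯 → Set
  IsEvent A = A ∙ A ≡ A

module _ {R : Reals} (T : RAlgebra R) where
  open Reals R using (ℝ; 0r; _<_) renaming (-_ to -ʳ_; _≤_ to _≤ʳ_)
  open RAlgebra T

  record PlausiblePreorder : Set₁ where
    infix 4 _≲_
    field
      _≲_   : 𝒯 → 𝒯 → Set
      ev    : ∀ A → IsEvent A → ι 0r ≲ A
      add   : ∀ {X Y} → ι 0r ≲ X → ι 0r ≲ Y → ι 0r ≲ X + Y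
      scale : ∀ {X} (q : ℝ) → ι 0r ≲ X → 0r ≤ʳ q → ι 0r ≲ q • X
      diff⇒ : ∀ {X Y} → X ≲ Y → ι 0r ≲ Y - X
      ⇒diff : ∀ {X Y} → ι 0r ≲ Y - X → X ≲ Y

  Strict : (𝒯 → 𝒯 → Set) → 𝒯 → 𝒯 → Set
  Strict _≼_ X Y = (X ≼ Y) × ¬ (Y ≼ X)

  Cond : (𝒯 → 𝒯 → Set) → 𝒯 → 𝒯 → 𝒯 → Set
  Cond _≼_ C X Y = (X ∙ C) ≼ (Y ∙ C)

  data ExtReal : Set where
    fin : ℝ → ExtReal
    +∞ −∞ : ExtReal

  -- "E(X) = v" for the expectation induced by the relation ≼
  ExpIs : (𝒯 → 𝒯 → Set) → 𝒯 → ExtReal → Set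
  ExpIs _≼_ X (fin x) = ∀ ε → 0r < ε →
    Strict _≼_ (ι (-ʳ ε)) (X - ι x) × Strict _≼_ (X - ι x) (ι ε)
  ExpIs _≼_ X +∞ = ∀ y → Strict _≼_ (ι y) X
  ExpIs _≼_ X −∞ = ∀ y → Strict _≼_ X (ι y)

  CondExpIs : PlausiblePreorder → 𝒯 → 𝒯 → ExtReal → Set
  CondExpIs P X C v = ExpIs (Cond (PlausiblePreorder._≲_ P) C) X v

  CondProbIs : PlausiblePreorder → 𝒯 → 𝒯 → ExtReal → Set
  CondProbIs P C D v = CondExpIs P C D v

-- Write E = C.D. If E(X|E) = +∞, every y.E lies below X.E, which is D-bounded by p.D, so
-- y.E ≲ p.D for all reals y; rescaling gives E ≲ δ.D for every δ > 0, while 0 ≲ E since E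
-- is an event. These are the non-strict halves of P(C|D) = 0, and a strict half can only
-- fail when D ≲ 0; but then p.D ≲ 0, so X.E ≲ 0.E, contradicting E(X|E) = +∞.
-- The case E(X|E) = −∞ is the case +∞ for −X.
module Submission where

open import Level using (0ℓ)
open import Data.Product using (Σ; _×_; _,_; proj₁; proj₂)
open import Data.Sum using (_⊎_; inj₁; inj₂; [_,_])
open import Data.Empty using (⊥-elim)
open import Relation.Nullary using (¬_)
open import Relation.Binary.PropositionalEquality
open import Algebra.Bundles using (CommutativeRing)
import Algebra.Definitions as Laws
import Algebra.Properties.Ring as RingProperties
import Algebra.Properties.CommutativeSemigroup as CommutativeSemigroupProperties
open import Defs

commutativeRing : (A : Set) (0# 1# : A) (_+_ _*_ : A → A → A) (-_ : A → A) →
  Laws.Associative _≡_ _+_ → Laws.Commutative _≡_ _+_ →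
  Laws.LeftIdentity _≡_ 0# _+_ → Laws.LeftInverse _≡_ 0# -_ _+_ →
  Laws.Associative _≡_ _*_ → Laws.Commutative _≡_ _*_ →
  Laws.LeftIdentity _≡_ 1# _*_ → Laws._DistributesOverˡ_ _≡_ _*_ _+_ →
  CommutativeRing 0ℓ 0ℓ
commutativeRing A 0# 1# _+_ _*_ -_ +-assoc +-comm +-idˡ +-invˡ *-assoc *-comm *-idˡ distribˡ =
  record
  { Carrier = A ; _≈_ = _≡_ ; _+_ = _+_ ; _*_ = _*_ ; -_ = -_ ; 0# = 0# ; 1# = 1#
  ; isCommutativeRing = record
    { isRing = record
      { +-isAbelianGroup = record
        { isGroup = record
          { isMonoid = record
            { isSemigroup = record
              { isMagma = record { isEquivalence = isEquivalence ; ∙-cong = cong₂ _+_ }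
              ; assoc = +-assoc }
            ; identity = +-idˡ , λ x → trans (+-comm x 0#) (+-idˡ x) }
          ; inverse = +-invˡ , λ x → trans (+-comm x (- x)) (+-invˡ x)
          ; ⁻¹-cong = cong -_ }
        ; comm = +-comm }
      ; *-cong = cong₂ _*_
      ; *-assoc = *-assoc
      ; *-identity = *-idˡ , λ x → trans (*-comm x 1#) (*-idˡ x)
      ; distrib = distribˡ , λ x y z → begin
          (y + z) * x        ≡⟨ *-comm (y + z) x ⟩
          x * (y + z)        ≡⟨ distribˡ x y z ⟩
          (x * y) + (x * z)  ≡⟨ cong₂ _+_ (*-comm x y) (*-comm x z) ⟩
          (y * x) + (z * x)  ∎ }
    ; *-comm = *-comm } }
  where open ≡-Reasoning

module RealsProperties (R : Reals) where
  open Reals R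

  ℝ-commutativeRing : CommutativeRing 0ℓ 0ℓ
  ℝ-commutativeRing =
    commutativeRing ℝ 0r 1r _+_ _*_ -_ +-assoc +-comm +-idˡ +-invˡ *-assoc *-comm *-idˡ distribˡ

  open CommutativeRing ℝ-commutativeRing public
    using (+-identityʳ; -‿inverseʳ; *-identityʳ)
  open RingProperties (CommutativeRing.ring ℝ-commutativeRing) public
    using (-‿involutive; -0#≈0#; -‿distribʳ-*; -‿anti-homo-+; -1*x≈-x; \\-leftDividesˡ)

  neg-antitone : ∀ {x y} → x ≤ y → - y ≤ - x
  neg-antitone {x} {y} x≤y =
    subst₂ _≤_ (\\-leftDividesˡ x (- y)) y+[-x+-y]≡-x (+-mono-≤ (- x + - y) x≤y)
    where
    y+[-x+-y]≡-x : y + (- x + - y) ≡ - x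
    y+[-x+-y]≡-x = trans (cong (y +_) (+-comm (- x) (- y))) (\\-leftDividesˡ y (- x))

  x≤0⇒0≤-x : ∀ {x} → x ≤ 0r → 0r ≤ - x
  x≤0⇒0≤-x x≤0 = subst (_≤ _) -0#≈0# (neg-antitone x≤0)

  0≤x⇒-x≤0 : ∀ {x} → 0r ≤ x → - x ≤ 0r
  0≤x⇒-x≤0 0≤x = subst (_ ≤_) -0#≈0# (neg-antitone 0≤x)

  x-[x+x]≡-x : ∀ x → x + - (x + x) ≡ - x
  x-[x+x]≡-x x = trans (cong (x +_) (-‿anti-homo-+ x x)) (\\-leftDividesˡ x (- x))

  x≤y⇒0≤y-x : ∀ {x y} → x ≤ y → 0r ≤ y + - x
  x≤y⇒0≤y-x {x} {y} x≤y = subst (_≤ y + - x) (-‿inverseʳ x) (+-mono-≤ (- x) x≤y)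

  +-nonneg : ∀ {x y} → 0r ≤ x → 0r ≤ y → 0r ≤ x + y
  +-nonneg {x} {y} 0≤x 0≤y = ≤-trans 0≤y (subst (_≤ x + y) (+-idˡ y) (+-mono-≤ y 0≤x))

  0≤1 : 0r ≤ 1r
  0≤1 with ≤-total 0r 1r
  ... | inj₁ 0≤1 = 0≤1
  ... | inj₂ 1≤0 = ⊥-elim (0≢1 (≤-antisym 0≤[-1]*[-1] 1≤0))
    where
    0≤[-1]*[-1] : 0r ≤ 1r
    0≤[-1]*[-1] = subst (0r ≤_) (trans (-1*x≈-x (- 1r)) (-‿involutive 1r))
                    (*-nonneg (x≤0⇒0≤-x 1≤0) (x≤0⇒0≤-x 1≤0))

  0<1 : 0r < 1r
  0<1 = 0≤1 , 0≢1

  inverse-nonneg : ∀ {x y} → 0r ≤ x → x * y ≡ 1r → 0r ≤ y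
  inverse-nonneg {x} {y} 0≤x xy≡1 with ≤-total 0r y
  ... | inj₁ 0≤y = 0≤y
  ... | inj₂ y≤0 = ⊥-elim (0≢1 (≤-antisym 0≤1 1≤0))
    where
    0≤-1 : 0r ≤ - 1r
    0≤-1 = subst (0r ≤_) (trans (sym (-‿distribʳ-* x y)) (cong -_ xy≡1))
             (*-nonneg 0≤x (x≤0⇒0≤-x y≤0))
    1≤0 : 1r ≤ 0r
    1≤0 = subst₂ _≤_ (-‿involutive 1r) -0#≈0# (neg-antitone 0≤-1)

  positive-inverse : ∀ {x} → 0r < x → Σ ℝ (λ y → (x * y ≡ 1r) × (0r ≤ y))
  positive-inverse {x} (0≤x , 0≢x) with *-inv x (λ x≡0 → 0≢x (sym x≡0))
  ... | y , xy≡1 = y , xy≡1 , inverse-nonneg 0≤x xy≡1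

  positive-upperBound : ∀ p → Σ ℝ (λ q → (p ≤ q) × (0r < q))
  positive-upperBound p with ≤-total p 1r
  ... | inj₁ p≤1 = 1r , p≤1 , 0<1
  ... | inj₂ 1≤p = p , ≤-refl p , ≤-trans 0≤1 1≤p , 0≢p
    where
    0≢p : 0r ≢ p
    0≢p 0≡p = 0≢1 (≤-antisym 0≤1 (subst (1r ≤_) (sym 0≡p) 1≤p))

  0<2 : 0r < 1r + 1r
  0<2 = +-nonneg 0≤1 0≤1 , 0≢2
    where
    0≢2 : 0r ≢ 1r + 1r
    0≢2 0≡2 = 0≢1 (≤-antisym 0≤1 (subst₂ _≤_ (+-idˡ 1r) (sym 0≡2) (+-mono-≤ 1r 0≤1)))

  half : ∀ {ε} → 0r < ε → Σ ℝ (λ δ → (0r < δ) × (δ + δ ≡ ε))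
  half {ε} (0≤ε , 0≢ε) with positive-inverse 0<2
  ... | t , 2t≡1 , 0≤t = ε * t , (*-nonneg 0≤ε 0≤t , 0≢εt) , εt+εt≡ε
    where
    t+t≡1 : t + t ≡ 1r
    t+t≡1 = begin
      t + t               ≡⟨ sym (cong₂ _+_ (*-identityʳ t) (*-identityʳ t)) ⟩
      t * 1r + t * 1r     ≡⟨ sym (distribˡ t 1r 1r) ⟩
      t * (1r + 1r)       ≡⟨ *-comm t (1r + 1r) ⟩
      (1r + 1r) * t       ≡⟨ 2t≡1 ⟩
      1r                  ∎
      where open ≡-Reasoning
    εt+εt≡ε : ε * t + ε * t ≡ ε
    εt+εt≡ε = trans (sym (distribˡ ε t t)) (trans (cong (ε *_) t+t≡1) (*-identityʳ ε))
    0≢εt : 0r ≢ ε * t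
    0≢εt 0≡εt = 0≢ε (trans (sym (+-idˡ 0r)) (trans (cong₂ _+_ 0≡εt 0≡εt) εt+εt≡ε))

module RAlgebraProperties {R : Reals} (T : RAlgebra R) where
  open Reals R using (0r; 1r) renaming (_+_ to _+ʳ_; _*_ to _*ʳ_; -_ to -ʳ_)
  open RAlgebra T

  𝒯-commutativeRing : CommutativeRing 0ℓ 0ℓ
  𝒯-commutativeRing =
    commutativeRing 𝒯 𝟎 𝟏 _+_ _∙_ -_ +-assoc +-comm +-idˡ +-invˡ ∙-assoc ∙-comm ∙-idˡ distribˡ

  open CommutativeRing 𝒯-commutativeRing public using (+-identityʳ)
  open RingProperties (CommutativeRing.ring 𝒯-commutativeRing) public
    using (-‿involutive; -0#≈0#; -‿distribˡ-*; x+x≈x⇒x≈0; +-inverseˡ-unique; \\-leftDividesʳ)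
  open CommutativeSemigroupProperties (CommutativeRing.*-commutativeSemigroup 𝒯-commutativeRing)
    using (interchange)

  •-zeroˡ : ∀ x → 0r • x ≡ 𝟎
  •-zeroˡ x = x+x≈x⇒x≈0 (0r • x)
    (trans (sym (•-distrib-+ʳ 0r 0r x)) (cong (_• x) (Reals.+-idˡ R 0r)))

  •-zeroʳ : ∀ r → r • 𝟎 ≡ 𝟎
  •-zeroʳ r = x+x≈x⇒x≈0 (r • 𝟎) (trans (sym (•-distrib-+ᵀ r 𝟎 𝟎)) (cong (r •_) (+-idˡ 𝟎)))

  ι0≡𝟎 : ι 0r ≡ 𝟎
  ι0≡𝟎 = •-zeroˡ 𝟏

  -‿distribˡ-• : ∀ r x → (-ʳ r) • x ≡ - (r • x)
  -‿distribˡ-• r x = +-inverseˡ-unique ((-ʳ r) • x) (r • x)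
    (trans (sym (•-distrib-+ʳ (-ʳ r) r x)) (trans (cong (_• x) (Reals.+-invˡ R r)) (•-zeroˡ x)))

  -‿distribʳ-• : ∀ r x → r • (- x) ≡ - (r • x)
  -‿distribʳ-• r x = +-inverseˡ-unique (r • (- x)) (r • x)
    (trans (sym (•-distrib-+ᵀ r (- x) x)) (trans (cong (r •_) (+-invˡ x)) (•-zeroʳ r)))

  -[[-r]•x]≡r•x : ∀ r x → - ((-ʳ r) • x) ≡ r • x
  -[[-r]•x]≡r•x r x = trans (cong -_ (-‿distribˡ-• r x)) (-‿involutive (r • x))

  0•x≡ι0 : ∀ x → 0r • x ≡ ι 0r
  0•x≡ι0 x = trans (•-zeroˡ x) (sym ι0≡𝟎)

  •-ι0 : ∀ r → r • ι 0r ≡ ι 0r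
  •-ι0 r = trans (cong (r •_) ι0≡𝟎) (trans (•-zeroʳ r) (sym ι0≡𝟎))

  -ι0≡ι0 : - ι 0r ≡ ι 0r
  -ι0≡ι0 = trans (cong -_ ι0≡𝟎) (trans -0#≈0# (sym ι0≡𝟎))

  x-ι0≡x : ∀ x → x - ι 0r ≡ x
  x-ι0≡x x = trans (cong (x +_) -ι0≡ι0) (trans (cong (x +_) ι0≡𝟎) (+-identityʳ x))

  ι-∙ : ∀ r x → ι r ∙ x ≡ r • x
  ι-∙ r x = trans (•-∙ r 𝟏 x) (cong (r •_) (∙-idˡ x))

  •-inverse : ∀ {c c′} → c *ʳ c′ ≡ 1r → ∀ x → c′ • (c • x) ≡ x
  •-inverse {c} {c′} cc′≡1 x =
    trans (sym (•-assoc c′ c x)) (trans (cong (_• x) (trans (Reals.*-comm R c′ c) cc′≡1)) (•-id x))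

  •-sub : ∀ s r x → (s • x) - (r • x) ≡ (s +ʳ -ʳ r) • x
  •-sub s r x = trans (cong (s • x +_) (sym (-‿distribˡ-• r x))) (sym (•-distrib-+ʳ s (-ʳ r) x))

  ∙-isEvent : ∀ {C D} → IsEvent C → IsEvent D → IsEvent (C ∙ D)
  ∙-isEvent {C} {D} C∙C≡C D∙D≡D = trans (interchange C D C D) (cong₂ _∙_ C∙C≡C D∙D≡D)

module PlausiblePreorderProperties {R : Reals} {T : RAlgebra R} (P : PlausiblePreorder T) where
  open Reals R using (0r; 1r; _<_; ≤-total)
    renaming (_≤_ to _≤ʳ_; _+_ to _+ʳ_; _*_ to _*ʳ_; -_ to -ʳ_)
  open RAlgebra T
  open PlausiblePreorder P
  open RAlgebraProperties T
  private module ℝ = RealsProperties R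

  ≲-trans : ∀ {X Y Z} → X ≲ Y → Y ≲ Z → X ≲ Z
  ≲-trans {X} {Y} {Z} X≲Y Y≲Z =
    ⇒diff (subst (ι 0r ≲_) [Z-Y]+[Y-X]≡Z-X (add (diff⇒ Y≲Z) (diff⇒ X≲Y)))
    where
    [Z-Y]+[Y-X]≡Z-X : (Z - Y) + (Y - X) ≡ Z - X
    [Z-Y]+[Y-X]≡Z-X = trans (+-assoc Z (- Y) (Y - X)) (cong (Z +_) (\\-leftDividesʳ Y (- X)))

  -‿antitone-≲ : ∀ {X Y} → X ≲ Y → - Y ≲ - X
  -‿antitone-≲ {X} {Y} X≲Y = ⇒diff (subst (ι 0r ≲_) Y-X≡[-X]-[-Y] (diff⇒ X≲Y))
    where
    Y-X≡[-X]-[-Y] : Y - X ≡ (- X) - (- Y)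
    Y-X≡[-X]-[-Y] = trans (+-comm Y (- X)) (cong ((- X) +_) (sym (-‿involutive Y)))

  •-monoʳ-≲ : ∀ {X Y} q → 0r ≤ʳ q → X ≲ Y → q • X ≲ q • Y
  •-monoʳ-≲ {X} {Y} q 0≤q X≲Y = ⇒diff (subst (ι 0r ≲_) q[Y-X]≡qY-qX (scale q (diff⇒ X≲Y) 0≤q))
    where
    q[Y-X]≡qY-qX : q • (Y - X) ≡ (q • Y) - (q • X)
    q[Y-X]≡qY-qX = trans (•-distrib-+ᵀ q Y (- X)) (cong (q • Y +_) (-‿distribʳ-• q X))

  •-monoˡ-≲ : ∀ {D r s} → ι 0r ≲ D → r ≤ʳ s → r • D ≲ s • D
  •-monoˡ-≲ {D} {r} {s} 0≲D r≤s =
    ⇒diff (subst (ι 0r ≲_) (sym (•-sub s r D)) (scale _ 0≲D (ℝ.x≤y⇒0≤y-x r≤s)))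

  •-cancel-≲ : ∀ {X Y c c′} → c *ʳ c′ ≡ 1r → 0r ≤ʳ c′ → c • X ≲ c • Y → X ≲ Y
  •-cancel-≲ {X} {Y} cc′≡1 0≤c′ cX≲cY =
    subst₂ _≲_ (•-inverse cc′≡1 X) (•-inverse cc′≡1 Y) (•-monoʳ-≲ _ 0≤c′ cX≲cY)

  D≲0⇒r•D≲0 : ∀ {D} → ι 0r ≲ D → D ≲ ι 0r → ∀ r → r • D ≲ ι 0r
  D≲0⇒r•D≲0 {D} 0≲D D≲0 r with ≤-total 0r r
  ... | inj₁ 0≤r = subst (r • D ≲_) (•-ι0 r) (•-monoʳ-≲ r 0≤r D≲0)
  ... | inj₂ r≤0 = subst₂ _≲_ (-[[-r]•x]≡r•x r D) -ι0≡ι0 (-‿antitone-≲ 0≲[-r]D)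
    where
    0≲[-r]D : ι 0r ≲ (-ʳ r) • D
    0≲[-r]D = subst (_≲ (-ʳ r) • D) (•-ι0 (-ʳ r)) (•-monoʳ-≲ (-ʳ r) (ℝ.x≤0⇒0≤-x r≤0) 0≲D)

  0≲[-δ]•D⇒D≲0 : ∀ {D δ} → 0r < δ → ι 0r ≲ (-ʳ δ) • D → D ≲ ι 0r
  0≲[-δ]•D⇒D≲0 {D} {δ} 0<δ 0≲[-δ]D with ℝ.positive-inverse 0<δ
  ... | e , δe≡1 , 0≤e = •-cancel-≲ δe≡1 0≤e δD≲δ0
    where
    δD≲δ0 : δ • D ≲ δ • ι 0r
    δD≲δ0 = subst₂ _≲_ (-[[-r]•x]≡r•x δ D) (trans -ι0≡ι0 (sym (•-ι0 δ))) (-‿antitone-≲ 0≲[-δ]D)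

  uniformBound⇒≲-positiveMultiples : ∀ {D E p} → ι 0r ≲ D → (∀ y → y • E ≲ p • D) →
    ∀ {δ} → 0r < δ → E ≲ δ • D
  uniformBound⇒≲-positiveMultiples {D} {E} {p} 0≲D yE≲pD {δ} 0<δ
    with ℝ.positive-upperBound p | ℝ.positive-inverse 0<δ
  ... | q , p≤q , 0<q | e , δe≡1 , _ with ℝ.positive-inverse 0<q
  ... | q′ , qq′≡1 , 0≤q′ =
    -- apply the bound at y = q/δ for a positive q ≥ p, then cancel q and 1/δ
    •-cancel-≲ (trans (Reals.*-comm R e δ) δe≡1) (proj₁ 0<δ) (•-cancel-≲ qq′≡1 0≤q′ qeE≲qeδD)
    where
    qeE≲qeδD : q • (e • E) ≲ q • (e • (δ • D))
    qeE≲qeδD = subst₂ _≲_ (•-assoc q e E) (cong (q •_) (sym (•-inverse δe≡1 D)))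
                 (≲-trans (yE≲pD (q *ʳ e)) (•-monoˡ-≲ 0≲D p≤q))

  condProb≡0 : ∀ {C D} → ι 0r ≲ D → ι 0r ≲ C ∙ D → (∀ {δ} → 0r < δ → C ∙ D ≲ δ • D) →
    ¬ (D ≲ ι 0r) → CondProbIs T P C D (fin 0r)
  condProb≡0 {C} {D} 0≲D 0≲CD CD≲δD D≴0 ε 0<ε =
    subst₂ (Strict T _≲_) (sym (ι-∙ (-ʳ ε) D)) (sym [C-0]D≡CD) (lower , upper-strict) ,
    subst₂ (Strict T _≲_) (sym [C-0]D≡CD) (sym (ι-∙ ε D)) (CD≲δD 0<ε , lower-strict)
    where
    [C-0]D≡CD : (C - ι 0r) ∙ D ≡ C ∙ D
    [C-0]D≡CD = cong (_∙ D) (x-ι0≡x C)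
    lower : (-ʳ ε) • D ≲ C ∙ D
    lower = ≲-trans (subst ((-ʳ ε) • D ≲_) (0•x≡ι0 D)
                      (•-monoˡ-≲ 0≲D (ℝ.0≤x⇒-x≤0 (proj₁ 0<ε)))) 0≲CD
    upper-strict : ¬ (C ∙ D ≲ (-ʳ ε) • D)
    upper-strict CD≲-εD = D≴0 (0≲[-δ]•D⇒D≲0 0<ε (≲-trans 0≲CD CD≲-εD))
    lower-strict : ¬ (ε • D ≲ C ∙ D)
    lower-strict εD≲CD with ℝ.half 0<ε
    ... | δ , 0<δ , δ+δ≡ε = D≴0 (0≲[-δ]•D⇒D≲0 0<δ (subst (ι 0r ≲_) δD-εD≡[-δ]D
                              (diff⇒ (≲-trans εD≲CD (CD≲δD 0<δ)))))
      where
      δD-εD≡[-δ]D : (δ • D) - (ε • D) ≡ (-ʳ δ) • D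
      δD-εD≡[-δ]D = trans (•-sub δ ε D)
        (cong (_• D) (trans (cong (δ +ʳ_) (cong -ʳ_ (sym δ+δ≡ε))) (ℝ.x-[x+x]≡-x δ)))

  -‿reflect-≲ : ∀ {X Y} → - X ≲ - Y → Y ≲ X
  -‿reflect-≲ {X} {Y} -X≲-Y = subst₂ _≲_ (-‿involutive Y) (-‿involutive X) (-‿antitone-≲ -X≲-Y)

  −∞⇒neg+∞ : ∀ {X E} → CondExpIs T P X E −∞ → CondExpIs T P (- X) E +∞
  −∞⇒neg+∞ {X} {E} X=−∞ y with X=−∞ (-ʳ y)
  ... | XE≲[-y]E , [-y]E≴XE =
    subst₂ _≲_ -[[-y]E]≡yE -[XE]≡[-X]E (-‿antitone-≲ XE≲[-y]E) ,
    λ [-X]E≲yE → [-y]E≴XE (-‿reflect-≲ (subst₂ _≲_ (sym -[XE]≡[-X]E) (sym -[[-y]E]≡yE) [-X]E≲yE))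
    where
    -[[-y]E]≡yE : - (ι (-ʳ y) ∙ E) ≡ ι y ∙ E
    -[[-y]E]≡yE = trans (cong -_ (ι-∙ (-ʳ y) E)) (trans (-[[-r]•x]≡r•x y E) (sym (ι-∙ y E)))
    -[XE]≡[-X]E : - (X ∙ E) ≡ (- X) ∙ E
    -[XE]≡[-X]E = -‿distribˡ-* X E

  +∞-bounded⇒condProb≡0 : ∀ {X C D p} → IsEvent C → IsEvent D →
    CondExpIs T P X (C ∙ D) +∞ → X ∙ (C ∙ D) ≲ p • D → CondProbIs T P C D (fin 0r)
  +∞-bounded⇒condProb≡0 {X} {C} {D} {p} C-event D-event X=+∞ XE≲pD =
    condProb≡0 0≲D (ev (C ∙ D) (∙-isEvent C-event D-event))
      (uniformBound⇒≲-positiveMultiples 0≲D yE≲pD) D≴0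
    where
    0≲D : ι 0r ≲ D
    0≲D = ev D D-event
    yE≲pD : ∀ y → y • (C ∙ D) ≲ p • D
    yE≲pD y = ≲-trans (subst (_≲ X ∙ (C ∙ D)) (ι-∙ y (C ∙ D)) (proj₁ (X=+∞ y))) XE≲pD
    D≴0 : ¬ (D ≲ ι 0r)
    D≴0 D≲0 = proj₂ (X=+∞ 0r)
      (subst (X ∙ (C ∙ D) ≲_) ι0≡ι0∙E (≲-trans XE≲pD (D≲0⇒r•D≲0 0≲D D≲0 p)))
      where
      ι0≡ι0∙E : ι 0r ≡ ι 0r ∙ (C ∙ D)
      ι0≡ι0∙E = sym (trans (ι-∙ 0r (C ∙ D)) (0•x≡ι0 (C ∙ D)))

mainTheorem12 : (R : Reals) (T : RAlgebra R) (P : PlausiblePreorder T) →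
    (X C D : RAlgebra.𝒯 T) → RAlgebra.IsEvent T C → RAlgebra.IsEvent T D →
    (CondExpIs T P X (RAlgebra._∙_ T C D) +∞ ⊎ CondExpIs T P X (RAlgebra._∙_ T C D) −∞) →
    Σ (Reals.ℝ R) (λ p →
      Cond T (PlausiblePreorder._≲_ P) D (RAlgebra.ι T (Reals.-_ R p)) (RAlgebra._∙_ T X C)
      × Cond T (PlausiblePreorder._≲_ P) D (RAlgebra._∙_ T X C) (RAlgebra.ι T p)) →
    CondProbIs T P C D (fin (Reals.0r R))
mainTheorem12 R T P X C D C-event D-event X=±∞ (p , -p≲XC , XC≲p) =
  [_,_] (λ X=+∞ → +∞-bounded⇒condProb≡0 C-event D-event X=+∞ XE≲pD)
        (λ X=−∞ → +∞-bounded⇒condProb≡0 C-event D-event (−∞⇒neg+∞ X=−∞) [-X]E≲pD)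
        X=±∞
  where
  open RAlgebra T
  open RAlgebraProperties T
  open PlausiblePreorder P
  open PlausiblePreorderProperties P

  XE≲pD : X ∙ (C ∙ D) ≲ p • D
  XE≲pD = subst₂ _≲_ (∙-assoc X C D) (ι-∙ p D) XC≲p

  [-X]E≲pD : (- X) ∙ (C ∙ D) ≲ p • D
  [-X]E≲pD = subst₂ _≲_ (trans (cong -_ (∙-assoc X C D)) (-‿distribˡ-* X (C ∙ D)))
               (trans (cong -_ (ι-∙ (Reals.-_ R p) D)) (-[[-r]•x]≡r•x p D))
               (-‿antitone-≲ -p≲XC)
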